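{- Let $t\ge3$, let $(G,\mathcal F)$ be an instance of Extended $K_t$-Hitting with $\mathrm{opt}(G,\mathcal F)=\mathrm{opt}(G)+1$, and let $\mathcal B$ be a blocking set of $(G,\mathcal F)$. Then there exists $\overline{\mathcal B}\subseteq\mathcal B$ such that $\overline{\mathcal B}$ is a blocking set of $(G,\mathcal F)$ and $|\overline{\mathcal B}|\le 2^{(t-1)\mathsf{mmbs}_t(G)}\,\mathsf{mmbs}^\star_t(G)$.
   Context: A $t$-clique is a set of $t$ pairwise adjacent vertices; $\mathrm{opt}(G)$ is the minimum size of a set intersecting all $t$-cliques of $G$. An instance of Extended $K_t$-Hitting is a pair $(G,\mathcal F)$ with $\mathcal F$ a set of subsets $Z\subseteq V(G)$, $1\le|Z|\le t-1$, $G[Z]$ a clique; $\mathrm{opt}(G,\mathcal F)$ is the minimum size of a set intersecting all $t$-cliques and all $Z\in\mathcal F$; $(G,\mathcal F)$ is clean if $\mathrm{opt}(G,\mathcal F)=\mathrm{opt}(G)$. A blocking set of $(G,\mathcal F)$ is a set $\mathcal B$ of subsets $B\subseteq V(G)$ with $1\le|B|\le t-1$, $G[B]$ a clique, and $\mathrm{opt}(G,\mathcal F\cup\mathcal B)>\mathrm{opt}(G,\mathcal F)$. $\mathsf{mmbs}_t(G,\mathcal F)$ is the maximum size of an inclusion-wise minimal blocking set of $(G,\mathcal F)$; $\mathsf{mmbs}_t(G)$ is the maximum of $\mathsf{mmbs}_t(G,\mathcal F)$ over clean instances $(G,\mathcal F)$; $\mathsf{mmbs}^\star_t(G)$ is the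 maximum of $\mathsf{mmbs}_t(G')$ over all subgraphs $G'$ of $G$. -}

module Defs where

open import Data.Nat using (ℕ; zero; suc; _≤_; _<_; _⊓_; _∸_; _+_)
open import Data.Bool using (Bool; true; false; _∧_; _∨_; not; if_then_else_)
open import Data.Fin using (Fin)
open import Data.Fin.Properties using (_≟_)
open import Data.Fin.Subset using (Subset; ∣_∣)
open import Data.Vec using (Vec; []; _∷_; lookup)
open import Data.List using (List; []; _∷_; _++_; map; allFin; foldr; length; filterᵇ)
open import Data.Bool.ListAction using (all; any)
open import Data.Product using (Σ; ∃; _×_; _,_)
open import Data.Sum using (_⊎_)
open import Function.Definitions using (Injective)
open import Relation.Nullary using (does)
open import Relation.Binary.PropositionalEquality using (_≡_)

record Graph (n : ℕ) : Set where
  field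
    adj    : Fin n → Fin n → Bool
    sym    : ∀ i j → adj i j ≡ adj j i
    irrefl : ∀ i → adj i i ≡ false
open Graph public

subsets : (n : ℕ) → List (Subset n)
subsets zero    = [] ∷ []
subsets (suc n) = map (true ∷_) (subsets n) ++ map (false ∷_) (subsets n)

isClique : ∀ {n} → Graph n → Subset n → Bool
isClique {n} G K =
  all (λ i → all (λ j → not (lookup K i ∧ lookup K j) ∨ does (i ≟ j) ∨ adj G i j)
                 (allFin n))
      (allFin n)

isTClique : ∀ {n} → ℕ → Graph n → Subset n → Bool
isTClique t G K = isClique G K ∧ does (∣ K ∣ Data.Nat.≟ t)

meets : ∀ {n} → Subset n → Subset n → Bool
meets {n} X K = any (λ i → lookup X i ∧ lookup K i) (allFin n)

Family : ℕ → Set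
Family n = Subset n → Bool

∅ᶠ : ∀ {n} → Family n
∅ᶠ _ = false

_∪ᶠ_ : ∀ {n} → Family n → Family n → Family n
(F ∪ᶠ B) Z = F Z ∨ B Z

_⊆ᶠ_ : ∀ {n} → Family n → Family n → Set
F ⊆ᶠ B = ∀ Z → F Z ≡ true → B Z ≡ true

card : ∀ {n} → Family n → ℕ
card {n} F = length (filterᵇ F (subsets n))

hits : ∀ {n} → ℕ → Graph n → Family n → Subset n → Bool
hits {n} t G F X =
  all (λ K → not (isTClique t G K) ∨ meets X K) (subsets n) ∧
  all (λ Z → not (F Z) ∨ meets X Z) (subsets n)

-- opt(G,F): minimum size of a hitting set (V(G) itself always hits when t ≥ 1
-- and all members of F are nonempty, so n is a valid initial bound).
opt : ∀ {n} → ℕ → Graph n → Family n → ℕ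
opt {n} t G F =
  foldr (λ X acc → if hits t G F X then ∣ X ∣ ⊓ acc else acc) n (subsets n)

optG : ∀ {n} → ℕ → Graph n → ℕ
optG t G = opt t G ∅ᶠ

ValidFamily : ∀ {n} → ℕ → Graph n → Family n → Set
ValidFamily t G F =
  ∀ Z → F Z ≡ true → (1 ≤ ∣ Z ∣) × (∣ Z ∣ ≤ t ∸ 1) × (isClique G Z ≡ true)

Clean : ∀ {n} → ℕ → Graph n → Family n → Set
Clean t G F = ValidFamily t G F × (opt t G F ≡ optG t G)

Blocking : ∀ {n} → ℕ → Graph n → Family n → Family n → Set
Blocking t G F B = ValidFamily t G B × (opt t G F < opt t G (F ∪ᶠ B))

MinBlocking : ∀ {n} → ℕ → Graph n → Family n → Family n → Set
MinBlocking t G F B =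
  Blocking t G F B × (∀ B' → B' ⊆ᶠ B → Blocking t G F B' → B ⊆ᶠ B')

IsMaxOf : (ℕ → Set) → ℕ → Set
IsMaxOf P k = P k × (∀ j → P j → j ≤ k)

-- mmbs_t(G,F) = k  (maximum over the empty set taken as 0)
IsMmbsInst : ∀ {n} → ℕ → Graph n → Family n → ℕ → Set
IsMmbsInst t G F =
  IsMaxOf (λ j → (j ≡ 0) ⊎ Σ (Family _) (λ B → MinBlocking t G F B × (card B ≡ j)))

IsMmbs : ∀ {n} → ℕ → Graph n → ℕ → Set
IsMmbs t G =
  IsMaxOf (λ j → (j ≡ 0) ⊎ Σ (Family _) (λ F → Clean t G F × IsMmbsInst t G F j))

SubgraphVia : ∀ {m n} → Graph m → Graph n → (Fin m → Fin n) → Set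
SubgraphVia G' G f =
  Injective _≡_ _≡_ f × (∀ i j → adj G' i j ≡ true → adj G (f i) (f j) ≡ true)

IsMmbsStar : ∀ {n} → ℕ → Graph n → ℕ → Set
IsMmbsStar {n} t G =
  IsMaxOf (λ j → Σ ℕ (λ m → Σ (Graph m) (λ G' → Σ (Fin m → Fin n) (λ f →
                   SubgraphVia G' G f × IsMmbs t G' j))))

-- Let k = opt(G), so opt(G, F) = k + 1. Shrink B to a minimal blocking B̄ ⊆ B, and shrink F, which
-- blocks the clean instance (G, ∅), to a minimal blocking F₀ ⊆ F; then |F₀| ≤ mmbs(G), so the union U of
-- the members of F₀ has at most (t - 1) mmbs(G) vertices. By minimality each Z ∈ B̄ has a hitting set
-- X_Z of F ∪ (B̄ - Z) of size k + 1; sort the Z by their trace S = X_Z ∩ U. For a fixed trace S,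
-- isolate the vertices of S and keep only the members of F and B̄ that miss S. Since S meets every
-- member of F₀, a hitting set of the new graph plus S hits F₀, and X_Z minus S hits the new instance;
-- comparing sizes shows that the new instance is clean, that the restricted B̄ blocks it, and that
-- every Z with trace S lies in each of its blocking subfamilies. So each of the 2^|U| fibers has at
-- most mmbs⋆(G) members.

module Submission where

open import Defs
open import Data.Nat using (ℕ; _≤_; _*_; _∸_; _^_; suc)
open import Data.Product using (Σ; _×_)
open import Relation.Binary.PropositionalEquality using (_≡_)

open import Data.Bool using (Bool; true; false; _∧_; _∨_; not; if_then_else_)
open import Data.Bool.ListAction using (all; any)
open import Data.Bool.Properties using (T-≡; not-¬; ∧-zeroʳ; ∧-comm; ∧-distribʳ-∨)
import Data.Bool as Bool
open import Data.Fin using (Fin)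
import Data.Fin as Fin
open import Data.Fin.Properties using (_≟_)
open import Data.Fin.Subset using (Subset; Nonempty; ∣_∣; _∈_; _∉_; _⊆_; _∩_; _∪_; _─_; ⊤; ⋃; ⁅_⁆)
open import Data.Fin.Subset.Properties
  using (∈⊤; ∣⊤∣≡n; ∣⊥∣≡0; p⊆q⇒∣p∣≤∣q∣; x∈⁅x⁆; ∣⁅x⁆∣≡1; x∈p∩q⁺; p∩q⊆p; p⊆p∪q; q⊆p∪q; x∈p∧x∉q⇒x∈p─q; drop-∷-⊆)
open import Data.List using (List; []; _∷_; _++_; map; allFin; foldr; length; filterᵇ)
open import Data.List.Properties using (length-++; length-map; length-filter; filter-none)
open import Data.List.Membership.Propositional using (find; lose) renaming (_∈_ to _∈ₗ_)
open import Data.List.Membership.Propositional.Properties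
  using (∈-allFin; ∈-map⁺; ∈-++⁺ˡ; ∈-++⁺ʳ; ∈-filter⁺; ∈-filter⁻)
open import Data.List.Relation.Unary.Any using (here; there)
import Data.List.Relation.Unary.All as All
open import Data.List.Relation.Unary.All.Properties using (all⁺; all⁻)
open import Data.List.Relation.Unary.Any.Properties using (any⁺; any⁻)
open import Data.Nat using (zero; _+_; _⊓_; _<_; _≤?_; z≤n; s≤s; s≤s⁻¹)
open import Data.Nat.Properties hiding (_≟_)
open import Data.Product using (∃; _,_; proj₁; proj₂)
open import Data.Sum using (_⊎_; inj₁; inj₂)
open import Data.Vec using ([]; _∷_; lookup)
open import Data.Vec.Properties using ([]=⇒lookup; lookup⇒[]=)
import Data.Vec.Properties as Vec
import Data.Vec as Vec
open import Function using (_∘_; id; Equivalence)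
open import Relation.Nullary using (¬_; Dec; yes; no; does; T?)
open import Relation.Nullary.Decidable using (dec-true; dec-false; decidable-stable; ¬¬-excluded-middle)
open import Relation.Nullary.Negation using (¬¬-map; contradiction)
import Relation.Binary.PropositionalEquality as ≡
open import Relation.Binary.PropositionalEquality using (refl; trans; cong; cong₂; subst; _≢_; module ≡-Reasoning)

private
  variable
    n : ℕ
    t : ℕ
    a b : Bool

∧-true⁻ : a ∧ b ≡ true → a ≡ true × b ≡ true
∧-true⁻ {true} b≡true = refl , b≡true

∧-true⁺ : a ≡ true → b ≡ true → a ∧ b ≡ true
∧-true⁺ refl b≡true = b≡true

∨-true⁻ : a ∨ b ≡ true → a ≡ true ⊎ b ≡ true
∨-true⁻ {true}  _      = inj₁ refl
∨-true⁻ {false} b≡true = inj₂ b≡true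

∨-trueˡ : ∀ b → a ≡ true → a ∨ b ≡ true
∨-trueˡ _ refl = refl

∨-trueʳ : ∀ a → b ≡ true → a ∨ b ≡ true
∨-trueʳ true  _      = refl
∨-trueʳ false b≡true = b≡true

module _ {A : Set} {p : A → Bool} where

  all-true⁻ : ∀ {xs x} → all p xs ≡ true → x ∈ₗ xs → p x ≡ true
  all-true⁻ {xs} h x∈xs =
    Equivalence.to T-≡ (All.lookup (all⁺ p xs (Equivalence.from T-≡ h)) x∈xs)

  all-true⁺ : ∀ xs → (∀ x → p x ≡ true) → all p xs ≡ true
  all-true⁺ xs f = Equivalence.to T-≡ (all⁻ p (All.universal (Equivalence.from T-≡ ∘ f) xs))

  any-true⁺ : ∀ {xs x} → x ∈ₗ xs → p x ≡ true → any p xs ≡ true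
  any-true⁺ x∈xs px = Equivalence.to T-≡ (any⁺ p (lose x∈xs (Equivalence.from T-≡ px)))

  any-true⁻ : ∀ xs → any p xs ≡ true → ∃ λ x → x ∈ₗ xs × p x ≡ true
  any-true⁻ xs h =
    let x , x∈xs , px = find (any⁻ p xs (Equivalence.from T-≡ h))
    in x , x∈xs , Equivalence.to T-≡ px

∈-subsets : (Z : Subset n) → Z ∈ₗ subsets n
∈-subsets []          = here refl
∈-subsets (true ∷ Z)  = ∈-++⁺ˡ (∈-map⁺ (true ∷_) (∈-subsets Z))
∈-subsets (false ∷ Z) = ∈-++⁺ʳ (map (true ∷_) (subsets _)) (∈-map⁺ (false ∷_) (∈-subsets Z))

subsetsOf : Subset n → List (Subset n)
subsetsOf []          = [] ∷ []
subsetsOf (true ∷ U)  = map (true ∷_) (subsetsOf U) ++ map (false ∷_) (subsetsOf U)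
subsetsOf (false ∷ U) = map (false ∷_) (subsetsOf U)

length-subsetsOf : (U : Subset n) → length (subsetsOf U) ≡ 2 ^ ∣ U ∣
length-subsetsOf []          = refl
length-subsetsOf (false ∷ U) = trans (length-map (false ∷_) (subsetsOf U)) (length-subsetsOf U)
length-subsetsOf (true ∷ U)  = begin
  length (map (true ∷_) (subsetsOf U) ++ map (false ∷_) (subsetsOf U))
    ≡⟨ length-++ (map (true ∷_) (subsetsOf U)) ⟩
  length (map (true ∷_) (subsetsOf U)) + length (map (false ∷_) (subsetsOf U))
    ≡⟨ cong₂ _+_ (length-map (true ∷_) (subsetsOf U)) (length-map (false ∷_) (subsetsOf U)) ⟩
  length (subsetsOf U) + length (subsetsOf U)
    ≡⟨ cong (λ m → m + m) (length-subsetsOf U) ⟩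
  2 ^ ∣ U ∣ + 2 ^ ∣ U ∣
    ≡⟨ cong (2 ^ ∣ U ∣ +_) (≡.sym (+-identityʳ _)) ⟩
  2 ^ suc ∣ U ∣ ∎
  where open ≡-Reasoning

∩-∈-subsetsOf : (X U : Subset n) → X ∩ U ∈ₗ subsetsOf U
∩-∈-subsetsOf []          []          = here refl
∩-∈-subsetsOf (true ∷ X)  (true ∷ U)  = ∈-++⁺ˡ (∈-map⁺ (true ∷_) (∩-∈-subsetsOf X U))
∩-∈-subsetsOf (false ∷ X) (true ∷ U)  =
  ∈-++⁺ʳ (map (true ∷_) (subsetsOf U)) (∈-map⁺ (false ∷_) (∩-∈-subsetsOf X U))
∩-∈-subsetsOf (true ∷ X)  (false ∷ U) = ∈-map⁺ (false ∷_) (∩-∈-subsetsOf X U)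
∩-∈-subsetsOf (false ∷ X) (false ∷ U) = ∈-map⁺ (false ∷_) (∩-∈-subsetsOf X U)

∣p∪q∣≤∣p∣+∣q∣ : (p q : Subset n) → ∣ p ∪ q ∣ ≤ ∣ p ∣ + ∣ q ∣
∣p∪q∣≤∣p∣+∣q∣ []          []          = z≤n
∣p∪q∣≤∣p∣+∣q∣ (true ∷ p)  (true ∷ q)  = s≤s (≤-trans (∣p∪q∣≤∣p∣+∣q∣ p q) (+-monoʳ-≤ ∣ p ∣ (n≤1+n ∣ q ∣)))
∣p∪q∣≤∣p∣+∣q∣ (true ∷ p)  (false ∷ q) = s≤s (∣p∪q∣≤∣p∣+∣q∣ p q)
∣p∪q∣≤∣p∣+∣q∣ (false ∷ p) (true ∷ q)  rewrite +-suc ∣ p ∣ ∣ q ∣ = s≤s (∣p∪q∣≤∣p∣+∣q∣ p q)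
∣p∪q∣≤∣p∣+∣q∣ (false ∷ p) (false ∷ q) = ∣p∪q∣≤∣p∣+∣q∣ p q

∣p─q∣+∣q∣≡∣p∣ : (p q : Subset n) → q ⊆ p → ∣ p ─ q ∣ + ∣ q ∣ ≡ ∣ p ∣
∣p─q∣+∣q∣≡∣p∣ []      []          _   = refl
∣p─q∣+∣q∣≡∣p∣ (x ∷ p) (false ∷ q) q⊆p with x
... | true  = cong suc (∣p─q∣+∣q∣≡∣p∣ p q (drop-∷-⊆ q⊆p))
... | false = ∣p─q∣+∣q∣≡∣p∣ p q (drop-∷-⊆ q⊆p)
∣p─q∣+∣q∣≡∣p∣ (true ∷ p)  (true ∷ q) q⊆p =
  trans (+-suc _ _) (cong suc (∣p─q∣+∣q∣≡∣p∣ p q (drop-∷-⊆ q⊆p)))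
∣p─q∣+∣q∣≡∣p∣ (false ∷ p) (true ∷ q) q⊆p with () ← q⊆p Vec.here

∣⋃∣≤ : (Ws : List (Subset n)) {c : ℕ} → (∀ {W} → W ∈ₗ Ws → ∣ W ∣ ≤ c) → ∣ ⋃ Ws ∣ ≤ length Ws * c
∣⋃∣≤ {n} []       _ = ≤-reflexive (∣⊥∣≡0 n)
∣⋃∣≤ (W ∷ Ws) h = ≤-trans (∣p∪q∣≤∣p∣+∣q∣ W (⋃ Ws)) (+-mono-≤ (h (here refl)) (∣⋃∣≤ Ws (h ∘ there)))

⊆⋃ : ∀ {Ws : List (Subset n)} {W} → W ∈ₗ Ws → W ⊆ ⋃ Ws
⊆⋃ {Ws = W ∷ Ws} (here refl) = p⊆p∪q (⋃ Ws)
⊆⋃ {Ws = V ∷ Ws} (there W∈Ws) = q⊆p∪q V (⋃ Ws) ∘ ⊆⋃ W∈Ws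

nonempty : ∀ {K : Subset n} → 1 ≤ ∣ K ∣ → Nonempty K
nonempty {K = true ∷ K}  _ = Fin.zero , Vec.here
nonempty {K = false ∷ K} h = let i , i∈K = nonempty h in Fin.suc i , Vec.there i∈K

-- Hitting sets and opt

Meets : Subset n → Subset n → Set
Meets X K = ∃ λ i → i ∈ X × i ∈ K

meets⁺ : ∀ {X K : Subset n} → Meets X K → meets X K ≡ true
meets⁺ (i , i∈X , i∈K) = any-true⁺ (∈-allFin i) (∧-true⁺ ([]=⇒lookup i∈X) ([]=⇒lookup i∈K))

meets⁻ : ∀ {X K : Subset n} → meets X K ≡ true → Meets X K
meets⁻ {X = X} {K} h =
  let i , _ , Xi∧Ki = any-true⁻ (allFin _) h
      Xi , Ki = ∧-true⁻ Xi∧Ki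
  in i , lookup⇒[]= i X Xi , lookup⇒[]= i K Ki

meets-false⁻ : ∀ {X K : Subset n} → meets X K ≡ false → ¬ Meets X K
meets-false⁻ h X∩K with () ← trans (≡.sym (meets⁺ X∩K)) h

Meets-mono : ∀ {X X' K : Subset n} → X ⊆ X' → Meets X K → Meets X' K
Meets-mono X⊆X' (i , i∈X , i∈K) = i , X⊆X' i∈X , i∈K

Meets-─ : ∀ {X S K : Subset n} → ¬ Meets S K → Meets X K → Meets (X ─ S) K
Meets-─ S∩K≡∅ (i , i∈X , i∈K) = i , x∈p∧x∉q⇒x∈p─q i∈X (λ i∈S → S∩K≡∅ (i , i∈S , i∈K)) , i∈K

isClique⁻ : ∀ {G : Graph n} {K i j} → isClique G K ≡ true → i ∈ K → j ∈ K → i ≢ j → adj G i j ≡ true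
isClique⁻ {i = i} {j} h i∈K j∈K i≢j
  with all-true⁻ (all-true⁻ h (∈-allFin i)) (∈-allFin j)
... | ij-ok rewrite []=⇒lookup i∈K | []=⇒lookup j∈K | dec-false (i ≟ j) i≢j = ij-ok

isClique⁺ : ∀ {G : Graph n} {K} → (∀ {i j} → i ∈ K → j ∈ K → i ≢ j → adj G i j ≡ true) → isClique G K ≡ true
isClique⁺ {n} {G} {K} adjacent = all-true⁺ (allFin n) λ i → all-true⁺ (allFin n) (ij-ok i)
  where
  ij-ok : ∀ i j → not (lookup K i ∧ lookup K j) ∨ does (i ≟ j) ∨ adj G i j ≡ true
  ij-ok i j with lookup K i in Ki | lookup K j in Kj | i ≟ j
  ... | false | _     | _       = refl
  ... | true  | false | _       = refl
  ... | true  | true  | yes _   = refl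
  ... | true  | true  | no i≢j  = adjacent (lookup⇒[]= i K Ki) (lookup⇒[]= j K Kj) i≢j

isTClique-∣∣ : ∀ {G : Graph n} {K} → isTClique t G K ≡ true → ∣ K ∣ ≡ t
isTClique-∣∣ {t = t} {G = G} {K} h = ≡ᵇ⇒≡ ∣ K ∣ t (Equivalence.from T-≡ (proj₂ (∧-true⁻ {isClique G K} h)))

record Hitting (t : ℕ) (G : Graph n) (F : Family n) (X : Subset n) : Set where
  field
    hitsCliques : ∀ K → isTClique t G K ≡ true → Meets X K
    hitsMembers : ∀ Z → F Z ≡ true → Meets X Z
open Hitting

⇒-true⁻ : not a ∨ b ≡ true → a ≡ true → b ≡ true
⇒-true⁻ h refl = h

⇒-true⁺ : ∀ a → (a ≡ true → b ≡ true) → not a ∨ b ≡ true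
⇒-true⁺ true  f = f refl
⇒-true⁺ false _ = refl

hits⁻ : ∀ {G : Graph n} {F X} → hits t G F X ≡ true → Hitting t G F X
hits⁻ {n} h = let cliques , members = ∧-true⁻ h in record
  { hitsCliques = λ K → meets⁻ ∘ ⇒-true⁻ (all-true⁻ cliques (∈-subsets K))
  ; hitsMembers = λ Z → meets⁻ ∘ ⇒-true⁻ (all-true⁻ members (∈-subsets Z))
  }

hits⁺ : ∀ {G : Graph n} {F X} → Hitting t G F X → hits t G F X ≡ true
hits⁺ {n} {t} {G} {F} h = ∧-true⁺
  (all-true⁺ (subsets n) λ K → ⇒-true⁺ (isTClique t G K) (meets⁺ ∘ hitsCliques h K))
  (all-true⁺ (subsets n) λ Z → ⇒-true⁺ (F Z) (meets⁺ ∘ hitsMembers h Z))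

Hitting-anti : ∀ {G : Graph n} {F F' X} → F ⊆ᶠ F' → Hitting t G F' X → Hitting t G F X
Hitting-anti F⊆F' h = record { hitsCliques = hitsCliques h ; hitsMembers = λ Z → hitsMembers h Z ∘ F⊆F' Z }

⊤-Hitting : ∀ {G : Graph n} {F} → 1 ≤ t → ValidFamily t G F → Hitting t G F ⊤
⊤-Hitting {G = G} 1≤t valid = record
  { hitsCliques = λ K K-clique →
      let i , i∈K = nonempty {K = K} (subst (1 ≤_) (≡.sym (isTClique-∣∣ {G = G} {K} K-clique)) 1≤t) in i , ∈⊤ , i∈K
  ; hitsMembers = λ Z Z∈F → let i , i∈Z = nonempty {K = Z} (proj₁ (valid Z Z∈F)) in i , ∈⊤ , i∈Z
  }

module _ {A : Set} (size : A → ℕ) where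

  minSize : (A → Bool) → ℕ → List A → ℕ
  minSize p = foldr (λ x acc → if p x then size x ⊓ acc else acc)

  minSize-≤ : ∀ {p m xs x} → x ∈ₗ xs → p x ≡ true → minSize p m xs ≤ size x
  minSize-≤ {p} {xs = y ∷ xs} (here refl) px rewrite px = m⊓n≤m _ _
  minSize-≤ {p} {xs = y ∷ xs} (there x∈xs) px with p y
  ... | true  = ≤-trans (m⊓n≤n _ _) (minSize-≤ x∈xs px)
  ... | false = minSize-≤ x∈xs px

  minSize-attained : ∀ p m xs → minSize p m xs ≡ m ⊎ ∃ λ x → p x ≡ true × size x ≡ minSize p m xs
  minSize-attained p m []       = inj₁ refl
  minSize-attained p m (y ∷ xs) with p y in py
  ... | false = minSize-attained p m xs
  ... | true with ⊓-sel (size y) (minSize p m xs)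
  ...   | inj₁ y-min = inj₂ (y , py , ≡.sym y-min)
  ...   | inj₂ rest-min rewrite rest-min = minSize-attained p m xs

  minSize-anti : ∀ {p q} m xs → (∀ x → q x ≡ true → p x ≡ true) → minSize p m xs ≤ minSize q m xs
  minSize-anti m []       _   = ≤-refl
  minSize-anti {p} {q} m (y ∷ xs) q⇒p with q y in qy
  ... | true rewrite q⇒p y qy = ⊓-monoʳ-≤ (size y) (minSize-anti m xs q⇒p)
  ... | false with p y
  ...   | true  = ≤-trans (m⊓n≤n _ _) (minSize-anti m xs q⇒p)
  ...   | false = minSize-anti m xs q⇒p

opt≤∣∣ : ∀ {G : Graph n} {F X} → Hitting t G F X → opt t G F ≤ ∣ X ∣
opt≤∣∣ {X = X} h = minSize-≤ ∣_∣ (∈-subsets X) (hits⁺ h)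

-- opt returns n when no subset hits; ⊤ then hits and has size n.
opt-attained : ∀ {G : Graph n} {F} → 1 ≤ t → ValidFamily t G F →
               ∃ λ X → Hitting t G F X × ∣ X ∣ ≡ opt t G F
opt-attained {n} {t} {G} {F} 1≤t valid with minSize-attained ∣_∣ (hits t G F) n (subsets n)
... | inj₁ opt≡n           = ⊤ , ⊤-Hitting 1≤t valid , trans (∣⊤∣≡n n) (≡.sym opt≡n)
... | inj₂ (X , X-hits , ∣X∣≡opt) = X , hits⁻ X-hits , ∣X∣≡opt

opt-mono : ∀ {G : Graph n} {F F'} → F ⊆ᶠ F' → opt t G F ≤ opt t G F'
opt-mono {n} {t} {G} {F} {F'} F⊆F' =
  minSize-anti ∣_∣ n (subsets n) λ X X-hits → hits⁺ (Hitting-anti F⊆F' (hits⁻ {G = G} {F'} {X} X-hits))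

module _ {A : Set} where

  length-filterᵇ-mono : ∀ {p q : A → Bool} xs → (∀ x → p x ≡ true → q x ≡ true) →
                        length (filterᵇ p xs) ≤ length (filterᵇ q xs)
  length-filterᵇ-mono         []       _   = z≤n
  length-filterᵇ-mono {p} {q} (x ∷ xs) p⇒q with p x in px | q x in qx
  ... | true  | true  = s≤s (length-filterᵇ-mono xs p⇒q)
  ... | true  | false with () ← trans (≡.sym (p⇒q x px)) qx
  ... | false | true  = m≤n⇒m≤1+n (length-filterᵇ-mono xs p⇒q)
  ... | false | false = length-filterᵇ-mono xs p⇒q

  length-filterᵇ-∨ : ∀ (p q : A → Bool) xs →
                     length (filterᵇ (λ x → p x ∨ q x) xs) ≤ length (filterᵇ p xs) + length (filterᵇ q xs)
  length-filterᵇ-∨ p q []       = z≤n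
  length-filterᵇ-∨ p q (x ∷ xs) with p x | q x
  ... | true  | true  = s≤s (≤-trans (length-filterᵇ-∨ p q xs) (+-monoʳ-≤ (length (filterᵇ p xs)) (n≤1+n _)))
  ... | true  | false = s≤s (length-filterᵇ-∨ p q xs)
  ... | false | true  rewrite +-suc (length (filterᵇ p xs)) (length (filterᵇ q xs)) = s≤s (length-filterᵇ-∨ p q xs)
  ... | false | false = length-filterᵇ-∨ p q xs

card-mono : ∀ {C C' : Family n} → C ⊆ᶠ C' → card C ≤ card C'
card-mono {n} = length-filterᵇ-mono (subsets n)

card-∪ᶠ : ∀ (C C' : Family n) → card (C ∪ᶠ C') ≤ card C + card C'
card-∪ᶠ {n} C C' = length-filterᵇ-∨ C C' (subsets n)

card-∅ᶠ : card (∅ᶠ {n}) ≡ 0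
card-∅ᶠ {n} = cong length (filter-none (T? ∘ ∅ᶠ {n}) (All.universal (λ _ ()) (subsets n)))

card≤ : (C : Family n) → card C ≤ length (subsets n)
card≤ {n} C = length-filter (T? ∘ C) (subsets n)

card≤-if-member : ∀ {C : Family n} {c} → (∀ {Z} → C Z ≡ true → card C ≤ c) → card C ≤ c
card≤-if-member {n} {C} {c} bound = from-list (filterᵇ C (subsets n)) refl
  where
  from-list : ∀ Zs → filterᵇ C (subsets n) ≡ Zs → length Zs ≤ c
  from-list []      _  = z≤n
  from-list (Z ∷ _) eq =
    let Z∈filter = subst (Z ∈ₗ_) (≡.sym eq) (here refl)
        Z∈C = Equivalence.to T-≡ (proj₂ (∈-filter⁻ (T? ∘ C) {xs = subsets n} Z∈filter))
    in subst (_≤ c) (cong length eq) (bound Z∈C)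

⋃ᶠ : {A : Set} → List A → (A → Family n) → Family n
⋃ᶠ xs Cs Z = any (λ x → Cs x Z) xs

card-⋃ᶠ : ∀ {A : Set} xs (Cs : A → Family n) {c} → (∀ x → card (Cs x) ≤ c) → card (⋃ᶠ xs Cs) ≤ length xs * c
card-⋃ᶠ {n} []       Cs _     = ≤-reflexive (card-∅ᶠ {n})
card-⋃ᶠ (x ∷ xs) Cs bound =
  ≤-trans (card-∪ᶠ (Cs x) (⋃ᶠ xs Cs)) (+-mono-≤ (bound x) (card-⋃ᶠ xs Cs bound))

support : Family n → Subset n
support {n} C = ⋃ (filterᵇ C (subsets n))

⊆-support : ∀ {C : Family n} {W} → C W ≡ true → W ⊆ support C
⊆-support {n} {C} {W} W∈C = ⊆⋃ (∈-filter⁺ (T? ∘ C) (∈-subsets W) (Equivalence.from T-≡ W∈C))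

∣support∣≤ : ∀ (C : Family n) {c} → (∀ W → C W ≡ true → ∣ W ∣ ≤ c) → ∣ support C ∣ ≤ card C * c
∣support∣≤ {n} C bound =
  ∣⋃∣≤ (filterᵇ C (subsets n)) λ W∈ → bound _ (Equivalence.to T-≡ (proj₂ (∈-filter⁻ (T? ∘ C) {xs = subsets n} W∈)))

-- Minimal blocking subfamilies

infix 4 _≟ˢ_

_≟ˢ_ : (X Y : Subset n) → Dec (X ≡ Y)
_≟ˢ_ = Vec.≡-dec Bool._≟_

infixl 30 _-ᶠ_

_-ᶠ_ : Family n → Subset n → Family n
(C -ᶠ Z) W = C W ∧ not (does (W ≟ˢ Z))

-ᶠ-⊆ᶠ : ∀ {C : Family n} {Z} → C -ᶠ Z ⊆ᶠ C
-ᶠ-⊆ᶠ W = proj₁ ∘ ∧-true⁻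

-ᶠ-removes : ∀ (C : Family n) Z → (C -ᶠ Z) Z ≢ true
-ᶠ-removes C Z rewrite dec-true (Z ≟ˢ Z) refl | ∧-zeroʳ (C Z) = λ ()

-ᶠ-mono : ∀ {C C' : Family n} {Z} → C ⊆ᶠ C' → C -ᶠ Z ⊆ᶠ C' -ᶠ Z
-ᶠ-mono {C = C} C⊆C' W W∈C-Z = let W∈C , W≢Z = ∧-true⁻ {C W} W∈C-Z in ∧-true⁺ (C⊆C' W W∈C) W≢Z

⊆ᶠ-ᶠ : ∀ {C M : Family n} {Z} → M ⊆ᶠ C → M Z ≡ false → M ⊆ᶠ C -ᶠ Z
⊆ᶠ-ᶠ {Z = Z} M⊆C Z∉M W W∈M with W ≟ˢ Z
... | yes refl with () ← trans (≡.sym W∈M) Z∉M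
... | no _     = ∧-true⁺ (M⊆C W W∈M) refl

∪ᶠ-monoʳ : ∀ (F : Family n) {C C'} → C ⊆ᶠ C' → (F ∪ᶠ C) ⊆ᶠ (F ∪ᶠ C')
∪ᶠ-monoʳ F C⊆C' Z Z∈F∪C with ∨-true⁻ {F Z} Z∈F∪C
... | inj₁ Z∈F = ∨-trueˡ _ Z∈F
... | inj₂ Z∈C = ∨-trueʳ (F Z) (C⊆C' Z Z∈C)

ValidFamily-anti : ∀ {G : Graph n} {C C'} → C ⊆ᶠ C' → ValidFamily t G C' → ValidFamily t G C
ValidFamily-anti C⊆C' valid Z = valid Z ∘ C⊆C' Z

ValidFamily-∪ᶠ : ∀ {G : Graph n} {F C} → ValidFamily t G F → ValidFamily t G C → ValidFamily t G (F ∪ᶠ C)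
ValidFamily-∪ᶠ {F = F} validF validC Z Z∈F∪C with ∨-true⁻ {F Z} Z∈F∪C
... | inj₁ Z∈F = validF Z Z∈F
... | inj₂ Z∈C = validC Z Z∈C

module Pruning {P : Family n → Set} (P? : ∀ C → Dec (P C)) (P-up : ∀ {C C'} → C ⊆ᶠ C' → P C → P C') where

  essential : ∀ {C M Z} → ¬ P (C -ᶠ Z) → M ⊆ᶠ C → P M → M Z ≡ true
  essential {M = M} {Z} ¬P M⊆C PM with M Z in Z∈M
  ... | true  = refl
  ... | false = contradiction (P-up (⊆ᶠ-ᶠ M⊆C Z∈M) PM) ¬P

  prune : List (Subset n) → Family n → Family n
  prune []       C = C
  prune (Z ∷ Zs) C with P? (C -ᶠ Z)
  ... | yes _ = prune Zs (C -ᶠ Z)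
  ... | no  _ = prune Zs C

  prune-⊆ᶠ : ∀ Zs C → prune Zs C ⊆ᶠ C
  prune-⊆ᶠ []       C W = id
  prune-⊆ᶠ (Z ∷ Zs) C with P? (C -ᶠ Z)
  ... | yes _ = λ W → -ᶠ-⊆ᶠ {C = C} W ∘ prune-⊆ᶠ Zs (C -ᶠ Z) W
  ... | no  _ = prune-⊆ᶠ Zs C

  prune-P : ∀ Zs {C} → P C → P (prune Zs C)
  prune-P []       PC = PC
  prune-P (Z ∷ Zs) {C} PC with P? (C -ᶠ Z)
  ... | yes PC-Z = prune-P Zs PC-Z
  ... | no  _    = prune-P Zs PC

  -- A member kept at its turn stays indispensable: later steps only shrink the family, and P is upward closed.
  prune-critical : ∀ {Zs C Z} → Z ∈ₗ Zs → prune Zs C Z ≡ true → ¬ P (prune Zs C -ᶠ Z)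
  prune-critical {Z' ∷ Zs} {C} (there Z∈Zs) with P? (C -ᶠ Z')
  ... | yes _ = prune-critical Z∈Zs
  ... | no  _ = prune-critical Z∈Zs
  prune-critical {Z ∷ Zs} {C} {Z} (here refl) Z∈R with P? (C -ᶠ Z)
  ... | yes _ = contradiction (prune-⊆ᶠ Zs (C -ᶠ Z) Z Z∈R) (-ᶠ-removes C Z)
  ... | no ¬PC-Z = ¬PC-Z ∘ P-up (-ᶠ-mono (prune-⊆ᶠ Zs C))

  minimal-subfamily : ∀ {C} → P C → ∃ λ R → R ⊆ᶠ C × P R × (∀ M → M ⊆ᶠ R → P M → R ⊆ᶠ M)
  minimal-subfamily {C} PC =
    R , prune-⊆ᶠ (subsets n) C , prune-P (subsets n) PC ,
    λ M M⊆R PM Z Z∈R → essential (prune-critical (∈-subsets Z) Z∈R) M⊆R PM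
    where R = prune (subsets n) C

Raises : ℕ → Graph n → Family n → Family n → Set
Raises t G F C = opt t G F < opt t G (F ∪ᶠ C)

module _ {t : ℕ} {G : Graph n} {F : Family n} where

  private
    open module RaisesPruning = Pruning {P = Raises t G F}
      (λ C → suc (opt t G F) ≤? opt t G (F ∪ᶠ C))
      (λ C⊆C' raises → <-≤-trans raises (opt-mono {t = t} {G = G} (∪ᶠ-monoʳ F C⊆C')))
      using (essential; minimal-subfamily)

  ∈-Raises-subfamily : ∀ {C M Z} → ¬ Raises t G F (C -ᶠ Z) → M ⊆ᶠ C → Raises t G F M → M Z ≡ true
  ∈-Raises-subfamily = essential

  MinBlocking-subfamily : ∀ {B} → Blocking t G F B → ∃ λ B̄ → B̄ ⊆ᶠ B × MinBlocking t G F B̄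
  MinBlocking-subfamily (validB , raisesB) =
    let B̄ , B̄⊆B , raisesB̄ , minimal = minimal-subfamily raisesB
    in B̄ , B̄⊆B , (ValidFamily-anti {t = t} {G = G} B̄⊆B validB , raisesB̄) , λ M M⊆B̄ → minimal M M⊆B̄ ∘ proj₂

  MinBlocking-critical : ∀ {B̄ Z} → MinBlocking t G F B̄ → B̄ Z ≡ true → ¬ Raises t G F (B̄ -ᶠ Z)
  MinBlocking-critical {B̄} {Z} ((validB̄ , _) , minimal) Z∈B̄ raises =
    -ᶠ-removes B̄ Z (minimal (B̄ -ᶠ Z) B̄-Z⊆B̄ (validB̄-Z , raises) Z Z∈B̄)
    where
    B̄-Z⊆B̄ : B̄ -ᶠ Z ⊆ᶠ B̄
    B̄-Z⊆B̄ = -ᶠ-⊆ᶠ {C = B̄}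
    validB̄-Z : ValidFamily t G (B̄ -ᶠ Z)
    validB̄-Z = ValidFamily-anti {t = t} {G = G} B̄-Z⊆B̄ validB̄

-- The maxima defining mmbs exist only classically, so bounds by them are proved under ¬¬.

¬¬-IsMaxOf : ∀ {P : ℕ → Set} → P 0 → ∀ N → (∀ j → P j → j ≤ N) → ¬ ¬ ∃ (IsMaxOf P)
¬¬-IsMaxOf P0 zero    bound ¬max = ¬max (0 , P0 , bound)
¬¬-IsMaxOf {P} P0 (suc N) bound ¬max = ¬¬-excluded-middle λ where
  (yes PN) → ¬max (suc N , PN , bound)
  (no ¬PN) → ¬¬-IsMaxOf P0 N (λ j Pj → s≤s⁻¹ (≤∧≢⇒< (bound j Pj) λ { refl → ¬PN Pj })) ¬max

module _ {t : ℕ} {G : Graph n} where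

  mmbsInst-candidate-≤ : ∀ {F} j → (j ≡ 0) ⊎ Σ (Family n) (λ B → MinBlocking t G F B × (card B ≡ j)) →
                         j ≤ length (subsets n)
  mmbsInst-candidate-≤ _ (inj₁ refl)          = z≤n
  mmbsInst-candidate-≤ _ (inj₂ (B , _ , refl)) = card≤ B

  mmbs-candidate-≤ : ∀ j → (j ≡ 0) ⊎ Σ (Family n) (λ F → Clean t G F × IsMmbsInst t G F j) →
                     j ≤ length (subsets n)
  mmbs-candidate-≤ _ (inj₁ refl)             = z≤n
  mmbs-candidate-≤ j (inj₂ (_ , _ , j-max)) = mmbsInst-candidate-≤ j (proj₁ j-max)

  card≤mmbs : ∀ {F M c} → Clean t G F → MinBlocking t G F M → IsMmbs t G c → card M ≤ c
  card≤mmbs {F} {M} {c} clean M-min (_ , c-max) =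
    decidable-stable (card M ≤? c) (¬¬-map bound (¬¬-IsMaxOf (inj₁ refl) _ (mmbsInst-candidate-≤ {F = F})))
    where
    bound : ∃ (IsMmbsInst t G F) → card M ≤ c
    bound (j , j-max) =
      ≤-trans (proj₂ j-max (card M) (inj₂ (M , M-min , refl))) (c-max j (inj₂ (F , clean , j-max)))

card≤mmbs⋆ : ∀ {m} {G' : Graph m} {G : Graph n} {f F' M c} → SubgraphVia G' G f →
             Clean t G' F' → MinBlocking t G' F' M → IsMmbsStar t G c → card M ≤ c
card≤mmbs⋆ {t = t} {m = m} {G'} {f = f} {M = M} {c} G'⊆G clean M-min (_ , c-max) =
  decidable-stable (card M ≤? c) (¬¬-map bound (¬¬-IsMaxOf (inj₁ refl) _ (mmbs-candidate-≤ {t = t} {G = G'})))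
  where
  bound : ∃ (IsMmbs t G') → card M ≤ c
  bound (j , j-max) = ≤-trans (card≤mmbs {t = t} {G = G'} clean M-min j-max) (c-max j (m , G' , f , G'⊆G , j-max))

-- Isolating a vertex set

-- G - S, kept on the vertex set of G (with S isolated) so that it is a subgraph via the identity.
isolate : Graph n → Subset n → Graph n
isolate G S = record
  { adj    = λ i j → adj G i j ∧ not (lookup S i) ∧ not (lookup S j)
  ; sym    = λ i j → cong₂ _∧_ (Graph.sym G i j) (∧-comm (not (lookup S i)) (not (lookup S j)))
  ; irrefl = λ i → cong (_∧ _) (Graph.irrefl G i)
  }

isolate-⊆ : ∀ (G : Graph n) S → SubgraphVia (isolate G S) G id
isolate-⊆ G S = id , λ i j → proj₁ ∘ ∧-true⁻

∉⇒not-lookup : ∀ {S : Subset n} {i} → i ∉ S → not (lookup S i) ≡ true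
∉⇒not-lookup {S = S} {i} i∉S with lookup S i in Si
... | true  = contradiction (lookup⇒[]= i S Si) i∉S
... | false = refl

isTClique-map : ∀ {G G' : Graph n} {K} → (isClique G K ≡ true → isClique G' K ≡ true) →
                isTClique t G K ≡ true → isTClique t G' K ≡ true
isTClique-map {G = G} {K = K} f h = let clique , size = ∧-true⁻ {isClique G K} h in ∧-true⁺ (f clique) size

isolate-isClique⁻ : ∀ {G : Graph n} {S K} → isClique (isolate G S) K ≡ true → isClique G K ≡ true
isolate-isClique⁻ {G = G} {S} {K} h =
  isClique⁺ {G = G} {K} λ i∈K j∈K i≢j → proj₁ (∧-true⁻ (isClique⁻ {G = isolate G S} {K} h i∈K j∈K i≢j))

isolate-isClique⁺ : ∀ {G : Graph n} {S K} → ¬ Meets S K → isClique G K ≡ true → isClique (isolate G S) K ≡ true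
isolate-isClique⁺ {G = G} {S} {K} S∩K≡∅ h = isClique⁺ {G = isolate G S} {K} λ i∈K j∈K i≢j →
  ∧-true⁺ (isClique⁻ {G = G} {K} h i∈K j∈K i≢j)
          (∧-true⁺ (∉⇒not-lookup λ i∈S → S∩K≡∅ (_ , i∈S , i∈K)) (∉⇒not-lookup λ j∈S → S∩K≡∅ (_ , j∈S , j∈K)))

isolate-adj-∈ : ∀ (G : Graph n) {S i} j → i ∈ S → adj (isolate G S) i j ≡ false
isolate-adj-∈ G j i∈S rewrite []=⇒lookup i∈S = ∧-zeroʳ (adj G _ j)

isolate-isClique-at : ∀ {G : Graph n} {S K i} → isClique (isolate G S) K ≡ true → i ∈ S → i ∈ K → K ⊆ ⁅ i ⁆
isolate-isClique-at {G = G} {S} {K} {i} h i∈S i∈K {j} j∈K with j ≟ i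
... | yes refl = x∈⁅x⁆ i
... | no j≢i =
  contradiction (isClique⁻ {G = isolate G S} {K} h i∈K j∈K (j≢i ∘ ≡.sym)) (not-¬ (isolate-adj-∈ G j i∈S))

isolate-avoids : ∀ {G : Graph n} {S K} → 2 ≤ t → isTClique t (isolate G S) K ≡ true → ¬ Meets S K
isolate-avoids {t = t} {G} {S} {K} 2≤t h (i , i∈S , i∈K) =
  contradiction ∣K∣≤1 (<⇒≱ (subst (2 ≤_) (≡.sym (isTClique-∣∣ {G = isolate G S} {K} h)) 2≤t))
  where
  K-clique : isClique (isolate G S) K ≡ true
  K-clique = proj₁ (∧-true⁻ {isClique (isolate G S) K} h)

  ∣K∣≤1 : ∣ K ∣ ≤ 1
  ∣K∣≤1 = ≤-trans (p⊆q⇒∣p∣≤∣q∣ (isolate-isClique-at {G = G} K-clique i∈S i∈K)) (≤-reflexive (∣⁅x⁆∣≡1 i))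

avoiding : Subset n → Family n → Family n
avoiding S H W = H W ∧ not (meets S W)

avoiding⁻ : ∀ {S : Subset n} {H W} → avoiding S H W ≡ true → H W ≡ true × ¬ Meets S W
avoiding⁻ {S = S} {H} {W} h with meets S W in S∩W | ∧-true⁻ {H W} h
... | false | W∈H , _ = W∈H , meets-false⁻ S∩W

avoiding⁺ : ∀ {S : Subset n} {H W} → H W ≡ true → ¬ Meets S W → avoiding S H W ≡ true
avoiding⁺ {S = S} {W = W} W∈H S∩W≡∅ with meets S W in S∩W
... | true  = contradiction (meets⁻ S∩W) S∩W≡∅
... | false = ∧-true⁺ W∈H refl

avoiding-∪ᶠ : ∀ (S : Subset n) F C W → avoiding S (F ∪ᶠ C) W ≡ (avoiding S F ∪ᶠ avoiding S C) W
avoiding-∪ᶠ S F C W = ∧-distribʳ-∨ (not (meets S W)) (F W) (C W)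

avoiding--ᶠ : ∀ {S : Subset n} {C Z} → avoiding S C -ᶠ Z ⊆ᶠ avoiding S (C -ᶠ Z)
avoiding--ᶠ {S = S} {C} {Z} W h =
  let W∈C-S , W≢Z = ∧-true⁻ {avoiding S C W} h
      W∈C , S∩W≡∅ = avoiding⁻ {S = S} {C} W∈C-S
  in avoiding⁺ {S = S} {C -ᶠ Z} (∧-true⁺ W∈C W≢Z) S∩W≡∅

ValidFamily-avoiding : ∀ {G : Graph n} {S H} → ValidFamily t G H → ValidFamily t (isolate G S) (avoiding S H)
ValidFamily-avoiding {G = G} {S} {H} valid W h =
  let W∈H , S∩W≡∅ = avoiding⁻ {S = S} {H} h
      1≤∣W∣ , ∣W∣≤t-1 , W-clique = valid W W∈H
  in 1≤∣W∣ , ∣W∣≤t-1 , isolate-isClique⁺ {G = G} S∩W≡∅ W-clique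

module _ {G : Graph n} {S : Subset n} {H H' : Family n} where

  Hitting-lift : ∀ {Y} → avoiding S H ⊆ᶠ H' → Hitting t (isolate G S) H' Y → Hitting t G H (Y ∪ S)
  Hitting-lift {t} {Y} H-S⊆H' h = record
    { hitsCliques = λ K K-clique → either K λ S∩K≡∅ →
        hitsCliques h K (isTClique-map {G = G} {isolate G S} {K} (isolate-isClique⁺ {G = G} S∩K≡∅) K-clique)
    ; hitsMembers = λ W W∈H → either W λ S∩W≡∅ → hitsMembers h W (H-S⊆H' W (avoiding⁺ {S = S} {H} W∈H S∩W≡∅))
    }
    where
    either : ∀ K → (¬ Meets S K → Meets Y K) → Meets (Y ∪ S) K
    either K f with meets S K in S∩K
    ... | true  = Meets-mono (q⊆p∪q Y S) (meets⁻ S∩K)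
    ... | false = Meets-mono (p⊆p∪q S) (f (meets-false⁻ S∩K))

  Hitting-restrict : ∀ {X} → 2 ≤ t → H' ⊆ᶠ avoiding S H → Hitting t G H X → Hitting t (isolate G S) H' (X ─ S)
  Hitting-restrict {t} 2≤t H'⊆H-S h = record
    { hitsCliques = λ K K-clique →
        Meets-─ (isolate-avoids {G = G} 2≤t K-clique)
                (hitsCliques h K (isTClique-map {G = isolate G S} {G} {K} (isolate-isClique⁻ {G = G} {S} {K}) K-clique))
    ; hitsMembers = λ W W∈H' → let W∈H , S∩W≡∅ = avoiding⁻ {S = S} {H} (H'⊆H-S W W∈H') in
        Meets-─ S∩W≡∅ (hitsMembers h W W∈H)
    }

  opt≤opt-isolate+∣∣ : 1 ≤ t → ValidFamily t (isolate G S) H' → avoiding S H ⊆ᶠ H' →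
                       opt t G H ≤ opt t (isolate G S) H' + ∣ S ∣
  opt≤opt-isolate+∣∣ {t} 1≤t valid H-S⊆H' =
    let Y , Y-hits , ∣Y∣≡opt = opt-attained 1≤t valid in begin
      opt t G H                          ≤⟨ opt≤∣∣ (Hitting-lift H-S⊆H' Y-hits) ⟩
      ∣ Y ∪ S ∣                          ≤⟨ ∣p∪q∣≤∣p∣+∣q∣ Y S ⟩
      ∣ Y ∣ + ∣ S ∣                      ≡⟨ cong (_+ ∣ S ∣) ∣Y∣≡opt ⟩
      opt t (isolate G S) H' + ∣ S ∣     ∎
    where open ≤-Reasoning

  opt-isolate+∣∣≤ : ∀ {X} → 2 ≤ t → H' ⊆ᶠ avoiding S H → Hitting t G H X → S ⊆ X →
                    opt t (isolate G S) H' + ∣ S ∣ ≤ ∣ X ∣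
  opt-isolate+∣∣≤ {t} {X} 2≤t H'⊆H-S h S⊆X = begin
    opt t (isolate G S) H' + ∣ S ∣   ≤⟨ +-monoˡ-≤ ∣ S ∣ (opt≤∣∣ (Hitting-restrict 2≤t H'⊆H-S h)) ⟩
    ∣ X ─ S ∣ + ∣ S ∣                ≡⟨ ∣p─q∣+∣q∣≡∣p∣ X S S⊆X ⟩
    ∣ X ∣                            ∎
    where open ≤-Reasoning

-- Fibers of B̄ by trace

module FiberBound {t : ℕ} (2≤t : 2 ≤ t) {G : Graph n} {F B̄ : Family n}
                  (validF : ValidFamily t G F) (optF : opt t G F ≡ suc (optG t G)) (B̄-min : MinBlocking t G F B̄)
                  {F₀ : Family n} (F₀⊆F : F₀ ⊆ᶠ F) (F₀-raises : Raises t G ∅ᶠ F₀) where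

  private
    k : ℕ
    k = optG t G

    U : Subset n
    U = support F₀

    1≤t : 1 ≤ t
    1≤t = ≤-trans (s≤s z≤n) 2≤t

    validB̄ : ValidFamily t G B̄
    validB̄ = proj₁ (proj₁ B̄-min)

  optimal-witness : ∀ Z → ∃ λ X → Hitting t G (F ∪ᶠ B̄ -ᶠ Z) X × ∣ X ∣ ≡ opt t G (F ∪ᶠ B̄ -ᶠ Z)
  optimal-witness Z =
    opt-attained {G = G} 1≤t
      (ValidFamily-∪ᶠ {t = t} {G = G} validF (ValidFamily-anti {t = t} {G = G} (-ᶠ-⊆ᶠ {C = B̄}) validB̄))

  witness : Subset n → Subset n
  witness Z = proj₁ (optimal-witness Z)

  witness-hits : ∀ Z → Hitting t G (F ∪ᶠ B̄ -ᶠ Z) (witness Z)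
  witness-hits Z = proj₁ (proj₂ (optimal-witness Z))

  ∣witness∣≤ : ∀ {Z} → B̄ Z ≡ true → ∣ witness Z ∣ ≤ suc k
  ∣witness∣≤ {Z} Z∈B̄ = begin
    ∣ witness Z ∣               ≡⟨ proj₂ (proj₂ (optimal-witness Z)) ⟩
    opt t G (F ∪ᶠ B̄ -ᶠ Z)       ≤⟨ ≮⇒≥ (MinBlocking-critical {t = t} {G = G} B̄-min Z∈B̄) ⟩
    opt t G F                   ≡⟨ optF ⟩
    suc k                       ∎
    where open ≤-Reasoning

  fiber : Subset n → Family n
  fiber S Z = B̄ Z ∧ does (witness Z ∩ U ≟ˢ S)

  fiber⁻ : ∀ {S Z} → fiber S Z ≡ true → B̄ Z ≡ true × witness Z ∩ U ≡ S
  fiber⁻ {S} {Z} h with witness Z ∩ U ≟ˢ S | ∧-true⁻ {B̄ Z} h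
  ... | yes trace≡S | Z∈B̄ , _ = Z∈B̄ , trace≡S

  B̄⊆⋃fiber : B̄ ⊆ᶠ ⋃ᶠ (subsetsOf U) fiber
  B̄⊆⋃fiber Z Z∈B̄ = any-true⁺ (∩-∈-subsetsOf (witness Z) U) (∧-true⁺ Z∈B̄ (dec-true (witness Z ∩ U ≟ˢ _) refl))

  -- Z₀ is any member of the fiber: an empty fiber needs no bound.
  module Fiber (S : Subset n) {Z₀} (Z₀∈fiber : fiber S Z₀ ≡ true) where

    G' : Graph n
    G' = isolate G S

    F' B' : Family n
    F' = avoiding S F
    B' = avoiding S B̄

    k' : ℕ
    k' = optG t G'

    restricted : Subset n → Family n
    restricted Z = F' ∪ᶠ B' -ᶠ Z

    S⊆witness : ∀ {Z} → fiber S Z ≡ true → S ⊆ witness Z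
    S⊆witness {Z} Z∈fiber i∈S = p∩q⊆p (witness Z) U (subst (_ ∈_) (≡.sym (proj₂ (fiber⁻ Z∈fiber))) i∈S)

    S-meets-F₀ : ∀ W → F₀ W ≡ true → Meets S W
    S-meets-F₀ W W∈F₀ =
      let i , i∈X , i∈W = hitsMembers (witness-hits Z₀) W (∨-trueˡ _ (F₀⊆F W W∈F₀))
      in i , subst (i ∈_) (proj₂ (fiber⁻ Z₀∈fiber)) (x∈p∩q⁺ (i∈X , ⊆-support W∈F₀ i∈W)) , i∈W

    k<k'+∣S∣ : suc k ≤ k' + ∣ S ∣
    k<k'+∣S∣ = ≤-trans F₀-raises (opt≤opt-isolate+∣∣ {G = G} {S} {F₀} {∅ᶠ} 1≤t (λ _ ()) F₀-S⊆∅ᶠ)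
      where
      F₀-S⊆∅ᶠ : avoiding S F₀ ⊆ᶠ ∅ᶠ
      F₀-S⊆∅ᶠ W h = let W∈F₀ , S∩W≡∅ = avoiding⁻ {S = S} {F₀} h in contradiction (S-meets-F₀ W W∈F₀) S∩W≡∅

    opt-restricted+∣S∣≤ : ∀ {Z} → fiber S Z ≡ true → opt t G' (restricted Z) + ∣ S ∣ ≤ suc k
    opt-restricted+∣S∣≤ {Z} Z∈fiber =
      ≤-trans (opt-isolate+∣∣≤ 2≤t restricted⊆ (witness-hits Z) (S⊆witness Z∈fiber))
              (∣witness∣≤ (proj₁ (fiber⁻ Z∈fiber)))
      where
      restricted⊆ : restricted Z ⊆ᶠ avoiding S (F ∪ᶠ B̄ -ᶠ Z)
      restricted⊆ W h = subst (_≡ true) (≡.sym (avoiding-∪ᶠ S F (B̄ -ᶠ Z) W))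
                              (∪ᶠ-monoʳ F' (avoiding--ᶠ {S = S} {B̄} {Z}) W h)

    k'≤opt : ∀ H → k' ≤ opt t G' H
    k'≤opt H = opt-mono {G = G'} λ _ ()

    opt-restricted≤k' : ∀ {Z} → fiber S Z ≡ true → opt t G' (restricted Z) ≤ k'
    opt-restricted≤k' Z∈fiber = +-cancelʳ-≤ ∣ S ∣ _ _ (≤-trans (opt-restricted+∣S∣≤ Z∈fiber) k<k'+∣S∣)

    optF'≡k' : opt t G' F' ≡ k'
    optF'≡k' = ≤-antisym (≤-trans (opt-mono {G = G'} λ W → ∨-trueˡ _) (opt-restricted≤k' Z₀∈fiber)) (k'≤opt F')

    validF' : ValidFamily t G' F'
    validF' = ValidFamily-avoiding {t = t} {G = G} {S} {F} validF

    validB' : ValidFamily t G' B'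
    validB' = ValidFamily-avoiding {t = t} {G = G} {S} {B̄} validB̄

    clean : Clean t G' F'
    clean = validF' , optF'≡k'

    B'-blocks : Blocking t G' F' B'
    B'-blocks = validB' , +-cancelʳ-≤ ∣ S ∣ _ _ (begin
      suc (opt t G' F') + ∣ S ∣   ≡⟨ cong (λ o → suc o + ∣ S ∣) optF'≡k' ⟩
      suc (k' + ∣ S ∣)            ≤⟨ s≤s (≤-trans (+-monoˡ-≤ ∣ S ∣ (k'≤opt (restricted Z₀)))
                                                  (opt-restricted+∣S∣≤ Z₀∈fiber)) ⟩
      suc (suc k)                 ≡⟨ cong suc (≡.sym optF) ⟩
      suc (opt t G F)             ≤⟨ proj₂ (proj₁ B̄-min) ⟩
      opt t G (F ∪ᶠ B̄)            ≤⟨ opt≤opt-isolate+∣∣ {G = G} {S} {F ∪ᶠ B̄} {F' ∪ᶠ B'} 1≤t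
                                       (ValidFamily-∪ᶠ {t = t} {G = G'} validF' validB')
                                       (λ W → subst (_≡ true) (avoiding-∪ᶠ S F B̄ W)) ⟩
      opt t G' (F' ∪ᶠ B') + ∣ S ∣ ∎)
      where open ≤-Reasoning

    fiber⊆ : ∀ {M} → M ⊆ᶠ B' → Raises t G' F' M → fiber S ⊆ᶠ M
    fiber⊆ M⊆B' M-raises Z Z∈fiber = ∈-Raises-subfamily {G = G'} restricted-not-raising M⊆B' M-raises
      where
      restricted-not-raising : ¬ Raises t G' F' (B' -ᶠ Z)
      restricted-not-raising raises =
        <⇒≱ raises (≤-trans (opt-restricted≤k' Z∈fiber) (≤-reflexive (≡.sym optF'≡k')))

    card-fiber≤ : ∀ {c} → IsMmbsStar t G c → card (fiber S) ≤ c
    card-fiber≤ mmbs⋆ =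
      let M , M⊆B' , M-min = MinBlocking-subfamily {t = t} {G = G'} {F'} B'-blocks
          (_ , M-raises) , _ = M-min
      in ≤-trans (card-mono (fiber⊆ {M} M⊆B' M-raises))
                 (card≤mmbs⋆ {t = t} {G' = G'} {G} (isolate-⊆ G S) clean M-min mmbs⋆)

  card≤2^∣support∣* : ∀ {c} → IsMmbsStar t G c → card B̄ ≤ 2 ^ ∣ support F₀ ∣ * c
  card≤2^∣support∣* {c} mmbs⋆ = begin
    card B̄                              ≤⟨ card-mono B̄⊆⋃fiber ⟩
    card (⋃ᶠ (subsetsOf U) fiber)       ≤⟨ card-⋃ᶠ (subsetsOf U) fiber fiber-bound ⟩
    length (subsetsOf U) * c            ≡⟨ cong (_* c) (length-subsetsOf U) ⟩
    2 ^ ∣ U ∣ * c                       ∎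
    where
    open ≤-Reasoning
    fiber-bound : ∀ S → card (fiber S) ≤ c
    fiber-bound S = card≤-if-member {C = fiber S} λ Z∈fiber → Fiber.card-fiber≤ S Z∈fiber mmbs⋆

∣support∣≤mmbs : ∀ {t} {G : Graph n} {F₀ mm} → MinBlocking t G ∅ᶠ F₀ → IsMmbs t G mm →
                 ∣ support F₀ ∣ ≤ (t ∸ 1) * mm
∣support∣≤mmbs {t = t} {G} {F₀} {mm} F₀-min mmbs = begin
  ∣ support F₀ ∣      ≤⟨ ∣support∣≤ F₀ (λ W W∈F₀ → proj₁ (proj₂ (proj₁ (proj₁ F₀-min) W W∈F₀))) ⟩
  card F₀ * (t ∸ 1)  ≤⟨ *-monoˡ-≤ (t ∸ 1) (card≤mmbs {t = t} {G = G} ((λ _ ()) , refl) F₀-min mmbs) ⟩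
  mm * (t ∸ 1)       ≡⟨ *-comm mm (t ∸ 1) ⟩
  (t ∸ 1) * mm       ∎
  where open ≤-Reasoning

lemma24 : ∀ {n} (t : ℕ) → 3 ≤ t → (G : Graph n) (F B : Family n) →
    ValidFamily t G F → opt t G F ≡ suc (optG t G) → Blocking t G F B →
    (mm mmStar : ℕ) → IsMmbs t G mm → IsMmbsStar t G mmStar →
    Σ (Family n) (λ B̄ → (B̄ ⊆ᶠ B) × Blocking t G F B̄ ×
                        (card B̄ ≤ 2 ^ ((t ∸ 1) * mm) * mmStar))
lemma24 t 3≤t G F B validF optF B-blocks mm mmStar mmbs mmbs⋆
  with B̄ , B̄⊆B , B̄-min ← MinBlocking-subfamily {t = t} {G = G} {F} B-blocks
     | F₀ , F₀⊆F , F₀-min@((_ , F₀-raises) , _)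
         ← MinBlocking-subfamily {t = t} {G = G} {∅ᶠ} (validF , ≤-reflexive (≡.sym optF))
  = B̄ , B̄⊆B , proj₁ B̄-min , (begin
    card B̄                        ≤⟨ FiberBound.card≤2^∣support∣* 2≤t {G = G} validF optF B̄-min F₀⊆F F₀-raises mmbs⋆ ⟩
    2 ^ ∣ support F₀ ∣ * mmStar    ≤⟨ *-monoˡ-≤ mmStar (^-monoʳ-≤ 2 (∣support∣≤mmbs {G = G} F₀-min mmbs)) ⟩
    2 ^ ((t ∸ 1) * mm) * mmStar   ∎)
  where
  open ≤-Reasoning
  2≤t : 2 ≤ t
  2≤t = ≤-trans (n≤1+n 2) 3≤t
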